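{- Consider a partial packing of the three bins $A,B,C$ (all current loads at most $22$) such that $s(C)<4$, $s(B)>6$ and $s(A)\ge s(B)+4-s(C)$. Then there exists an online algorithm that, continuing from this partial packing, packs all remaining items of the input sequence into the three bins so that every bin has load at most $22$.
   Context: Scaled setting of Online Bin Stretching with three bins: items with sizes in $[0,16]$ arrive online one by one and each must be packed immediately and irrevocably into one of three bins $A,B,C$; it is guaranteed that the whole input sequence (items already packed together with all future items) can be packed offline into three bins of capacity $16$. A partial packing is an assignment of each item of some prefix of the input sequence (the items arrived so far) to one of the bins $A,B,C$. For a bin $X$, $s(X)$ denotes the total size of items currently assigned to $X$. The online algorithm must handle every possible continuation of the input satisfying the guarantee.
   Formalization: Item sizes, of the items already packed and of every future item, are rational numbers in $[0,16]$, so the online algorithm is only required to handle rational items. -}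

module Defs where

open import Data.Nat using (ℕ)
open import Data.Integer using (+_)
open import Data.Rational using (ℚ; _/_; _+_; _≤_; 0ℚ)
open import Data.List using (List; []; _∷_; map; _++_)
open import Data.Product using (_×_; _,_; proj₁; Σ)
open import Relation.Binary.PropositionalEquality using (_≡_)

data Bin : Set where
  A B C : Bin

ℕ→ℚ : ℕ → ℚ
ℕ→ℚ n = (+ n) / 1

-- A (partial) packing: the items packed so far, in arrival order,
-- each together with the bin it was assigned to.
Packing : Set
Packing = List (ℚ × Bin)

contrib : Bin → Bin → ℚ → ℚ
contrib A A x = x
contrib B B x = x
contrib C C x = x
contrib _ _ _ = 0ℚ

load : Bin → Packing → ℚ
load X [] = 0ℚ
load X ((x , Y) ∷ p) = contrib X Y x + load X p

items : Packing → List ℚ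
items = map proj₁

LoadsAtMost : ℚ → Packing → Set
LoadsAtMost cap p = (X : Bin) → load X p ≤ cap

data ValidSizes : List ℚ → Set where
  []  : ValidSizes []
  _∷_ : ∀ {x xs} → (0ℚ ≤ x × x ≤ ℕ→ℚ 16) → ValidSizes xs → ValidSizes (x ∷ xs)

OfflinePackable16 : List ℚ → Set
OfflinePackable16 xs = Σ Packing λ p → (items p ≡ xs) × LoadsAtMost (ℕ→ℚ 16) p

OnlineAlg : Set
OnlineAlg = Packing → ℚ → Bin

run : OnlineAlg → Packing → List ℚ → Packing
run alg p []       = p
run alg p (x ∷ xs) = run alg (p ++ ((x , alg p x) ∷ [])) xs

-- Call a load vector balanced when s(B) + 4 ≤ s(A) + s(C), s(B) ≥ 4 and s(C) ≤ 6;
-- the hypotheses imply that the starting packing is balanced. While balanced,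
-- an item y goes to A if it fits there (staying balanced); otherwise to C if
-- s(B) + y ≥ 22, and then s(C) + y ≤ 6 + 16 = 22 and s(A) + s(C) ≥ s(B) + 4 + y ≥ 26;
-- otherwise to B, which then holds less than 22 while s(A) + y > 22 and s(B) ≥ 4
-- give s(A) + s(B) > 26. As soon as two bins together hold at least 26, the offline
-- bound of 3 · 16 = 48 on the total volume leaves at most 22 for everything that
-- the third bin will ever receive, so all later items go there.
module Submission where

open import Defs
open import Data.Rational using (ℚ; _+_; _-_; _≤_; _<_; 0ℚ)
open import Data.Rational.Properties
open import Data.Rational.Solver using (module +-*-Solver)
open import Data.List using (List; []; _∷_; _++_; [_]; foldr)
open import Data.List.Properties using (map-++; ++-assoc)
open import Data.Product using (Σ; _×_; _,_)
open import Relation.Binary.PropositionalEquality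
  using (_≡_; refl; sym; trans; cong; subst; module ≡-Reasoning)
open import Relation.Nullary using (yes; no)
open import Data.Empty using (⊥-elim)

open +-*-Solver using (solve; _:+_; _:-_; _:=_)

sumℚ : List ℚ → ℚ
sumℚ = foldr _+_ 0ℚ

sumℚ-++ : ∀ xs ys → sumℚ (xs ++ ys) ≡ sumℚ xs + sumℚ ys
sumℚ-++ []       ys = sym (+-identityˡ (sumℚ ys))
sumℚ-++ (x ∷ xs) ys = trans (cong (x +_) (sumℚ-++ xs ys)) (sym (+-assoc x (sumℚ xs) (sumℚ ys)))

sumℚ-nonNeg : ∀ {xs} → ValidSizes xs → 0ℚ ≤ sumℚ xs
sumℚ-nonNeg []              = ≤-refl
sumℚ-nonNeg ((0≤x , _) ∷ v) = +-mono-≤ 0≤x (sumℚ-nonNeg v)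

p≤p+q : ∀ p {q} → 0ℚ ≤ q → p ≤ p + q
p≤p+q p {q} 0≤q = subst (_≤ p + q) (+-identityʳ p) (+-monoʳ-≤ p 0≤q)

p+q≤r∧s≤p⇒q≤r-s : ∀ {p q r s} → p + q ≤ r → s ≤ p → q ≤ r - s
p+q≤r∧s≤p⇒q≤r-s {p} {q} {r} {s} p+q≤r s≤p =
  subst (_≤ r - s) (solve 2 (λ p q → (p :+ q) :- p := q) refl p q)
    (+-mono-≤ p+q≤r (neg-antimono-≤ s≤p))

p-q≤r⇒p≤r+q : ∀ {p q r} → p - q ≤ r → p ≤ r + q
p-q≤r⇒p≤r+q {p} {q} {r} p-q≤r =
  subst (_≤ r + q) (solve 2 (λ p q → (p :- q) :+ q := p) refl p q) (+-monoˡ-≤ q p-q≤r)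

record Loads : Set where
  constructor ⟨_,_,_⟩
  field
    loadA loadB loadC : ℚ

⟨⟩-cong : ∀ {a a′ b b′ c c′} → a ≡ a′ → b ≡ b′ → c ≡ c′ → ⟨ a , b , c ⟩ ≡ ⟨ a′ , b′ , c′ ⟩
⟨⟩-cong refl refl refl = refl

loads : Packing → Loads
loads q = ⟨ load A q , load B q , load C q ⟩

total : Loads → ℚ
total ⟨ a , b , c ⟩ = (a + b) + c

put : Bin → ℚ → Loads → Loads
put A y ⟨ a , b , c ⟩ = ⟨ a + y , b , c ⟩
put B y ⟨ a , b , c ⟩ = ⟨ a , b + y , c ⟩
put C y ⟨ a , b , c ⟩ = ⟨ a , b , c + y ⟩

total-put : ∀ Y y ℓ → total (put Y y ℓ) ≡ total ℓ + y
total-put A y ⟨ a , b , c ⟩ = solve 4 (λ a b c y → ((a :+ y) :+ b) :+ c := ((a :+ b) :+ c) :+ y) refl a b c y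
total-put B y ⟨ a , b , c ⟩ = solve 4 (λ a b c y → (a :+ (b :+ y)) :+ c := ((a :+ b) :+ c) :+ y) refl a b c y
total-put C y ⟨ a , b , c ⟩ = solve 4 (λ a b c y → (a :+ b) :+ (c :+ y) := ((a :+ b) :+ c) :+ y) refl a b c y

loads-∷ : ∀ y Y q → loads ((y , Y) ∷ q) ≡ put Y y (loads q)
loads-∷ y A q = ⟨⟩-cong (+-comm y (load A q)) (+-identityˡ (load B q)) (+-identityˡ (load C q))
loads-∷ y B q = ⟨⟩-cong (+-identityˡ (load A q)) (+-comm y (load B q)) (+-identityˡ (load C q))
loads-∷ y C q = ⟨⟩-cong (+-identityˡ (load A q)) (+-identityˡ (load B q)) (+-comm y (load C q))

load-++-[] : ∀ X q y Y → load X (q ++ [ (y , Y) ]) ≡ load X q + contrib X Y y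
load-++-[] X []            y Y = +-comm (contrib X Y y) 0ℚ
load-++-[] X ((x , Z) ∷ q) y Y =
  trans (cong (contrib X Z x +_) (load-++-[] X q y Y))
        (sym (+-assoc (contrib X Z x) (load X q) (contrib X Y y)))

loads-++-[] : ∀ q y Y → loads (q ++ [ (y , Y) ]) ≡ put Y y (loads q)
loads-++-[] q y A = ⟨⟩-cong (load-++-[] A q y A)
  (trans (load-++-[] B q y A) (+-identityʳ (load B q)))
  (trans (load-++-[] C q y A) (+-identityʳ (load C q)))
loads-++-[] q y B = ⟨⟩-cong (trans (load-++-[] A q y B) (+-identityʳ (load A q)))
  (load-++-[] B q y B)
  (trans (load-++-[] C q y B) (+-identityʳ (load C q)))
loads-++-[] q y C = ⟨⟩-cong (trans (load-++-[] A q y C) (+-identityʳ (load A q)))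
  (trans (load-++-[] B q y C) (+-identityʳ (load B q)))
  (load-++-[] C q y C)

sumℚ-items≡total : ∀ q → sumℚ (items q) ≡ total (loads q)
sumℚ-items≡total []            = refl
sumℚ-items≡total ((y , Y) ∷ q) = begin
  y + sumℚ (items q)      ≡⟨ cong (y +_) (sumℚ-items≡total q) ⟩
  y + total (loads q)     ≡⟨ +-comm y (total (loads q)) ⟩
  total (loads q) + y     ≡⟨ sym (total-put Y y (loads q)) ⟩
  total (put Y y (loads q)) ≡⟨ cong total (sym (loads-∷ y Y q)) ⟩
  total (loads ((y , Y) ∷ q)) ∎
  where open ≡-Reasoning

items-++-[] : ∀ q y Y r → items (q ++ [ (y , Y) ]) ++ r ≡ items q ++ y ∷ r
items-++-[] q y Y r = trans (cong (_++ r) (map-++ _ q [ (y , Y) ])) (++-assoc (items q) [ y ] r)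

run-preserves : (alg : OnlineAlg) (m : ℚ) (P : Packing → Set) →
  (∀ q y → 0ℚ ≤ y → y ≤ ℕ→ℚ 16 → sumℚ (items q) + y ≤ m → P q → P (q ++ [ (y , alg q y) ])) →
  ∀ q r → ValidSizes r → sumℚ (items q ++ r) ≤ m → P q → P (run alg q r)
run-preserves alg m P step q []      _                     _      Pq = Pq
run-preserves alg m P step q (y ∷ r) ((0≤y , y≤16) ∷ valid) budget Pq =
  run-preserves alg m P step (q ++ [ (y , alg q y) ]) r valid budget′
    (step q y 0≤y y≤16 budget-now Pq)
  where
  budget′ : sumℚ (items (q ++ [ (y , alg q y) ]) ++ r) ≤ m
  budget′ = subst (_≤ m) (sym (cong sumℚ (items-++-[] q y (alg q y) r))) budget
  budget-now : sumℚ (items q) + y ≤ m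
  budget-now = ≤-trans (+-monoʳ-≤ (sumℚ (items q)) (p≤p+q y (sumℚ-nonNeg valid)))
                 (subst (_≤ m) (sumℚ-++ (items q) (y ∷ r)) budget)

data Phase (a b c : ℚ) : Set where
  heavyAB  : ℕ→ℚ 26 ≤ a + b → Phase a b c
  heavyAC  : ℕ→ℚ 26 ≤ a + c → Phase a b c
  balanced : b + ℕ→ℚ 4 ≤ a + c → ℕ→ℚ 4 ≤ b → c ≤ ℕ→ℚ 6 → Phase a b c

Invariant : Loads → Set
Invariant ⟨ a , b , c ⟩ = (a ≤ ℕ→ℚ 22 × b ≤ ℕ→ℚ 22 × c ≤ ℕ→ℚ 22) × Phase a b c

balancedChoice : Loads → ℚ → Bin
balancedChoice ⟨ a , b , c ⟩ y with ℕ→ℚ 22 ≤? b + y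
... | yes _ = C
... | no _ with a + y ≤? ℕ→ℚ 22
...   | yes _ = A
...   | no _  = B

choose : Loads → ℚ → Bin
choose ⟨ a , b , c ⟩ y with ℕ→ℚ 26 ≤? a + b
... | yes _ = C
... | no _ with ℕ→ℚ 26 ≤? a + c
...   | yes _ = B
...   | no _  = balancedChoice ⟨ a , b , c ⟩ y

rest-≤22 : ∀ {u v} → ℕ→ℚ 26 ≤ u → u + v ≤ ℕ→ℚ 48 → v ≤ ℕ→ℚ 22
rest-≤22 26≤u u+v≤48 = p+q≤r∧s≤p⇒q≤r-s u+v≤48 26≤u

heavyAC-after-C : ∀ {a b c y} → b + ℕ→ℚ 4 ≤ a + c → ℕ→ℚ 22 ≤ b + y → ℕ→ℚ 26 ≤ a + (c + y)
heavyAC-after-C {a} {b} {c} {y} b+4≤a+c 22≤b+y = begin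
  ℕ→ℚ 26               ≤⟨ +-monoˡ-≤ (ℕ→ℚ 4) 22≤b+y ⟩
  (b + y) + ℕ→ℚ 4      ≡⟨ solve 3 (λ b y f → (b :+ y) :+ f := (b :+ f) :+ y) refl b y (ℕ→ℚ 4) ⟩
  (b + ℕ→ℚ 4) + y      ≤⟨ +-monoˡ-≤ y b+4≤a+c ⟩
  (a + c) + y          ≡⟨ +-assoc a c y ⟩
  a + (c + y)          ∎
  where open ≤-Reasoning

heavyAB-after-B : ∀ {a b y} → ℕ→ℚ 22 < a + y → ℕ→ℚ 4 ≤ b → ℕ→ℚ 26 ≤ a + (b + y)
heavyAB-after-B {a} {b} {y} 22<a+y 4≤b = begin
  ℕ→ℚ 26               <⟨ +-mono-<-≤ 22<a+y 4≤b ⟩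
  (a + y) + b          ≡⟨ solve 3 (λ a b y → (a :+ y) :+ b := a :+ (b :+ y)) refl a b y ⟩
  a + (b + y)          ∎
  where open ≤-Reasoning

balancedChoice-preserves : ∀ {a b c} y → 0ℚ ≤ y → y ≤ ℕ→ℚ 16 →
  a ≤ ℕ→ℚ 22 → b ≤ ℕ→ℚ 22 → c ≤ ℕ→ℚ 22 →
  b + ℕ→ℚ 4 ≤ a + c → ℕ→ℚ 4 ≤ b → c ≤ ℕ→ℚ 6 →
  Invariant (put (balancedChoice ⟨ a , b , c ⟩ y) y ⟨ a , b , c ⟩)
balancedChoice-preserves {a} {b} {c} y 0≤y y≤16 a≤22 b≤22 c≤22 b+4≤a+c 4≤b c≤6
  with ℕ→ℚ 22 ≤? b + y
... | yes 22≤b+y = (a≤22 , b≤22 , +-mono-≤ c≤6 y≤16) , heavyAC (heavyAC-after-C {a} {b} {c} {y} b+4≤a+c 22≤b+y)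
... | no 22≰b+y with a + y ≤? ℕ→ℚ 22
...   | yes a+y≤22 =
  (a+y≤22 , b≤22 , c≤22) , balanced (≤-trans b+4≤a+c (+-monoˡ-≤ c (p≤p+q a 0≤y))) 4≤b c≤6
...   | no a+y≰22  =
  (a≤22 , <⇒≤ (≰⇒> 22≰b+y) , c≤22) , heavyAB (heavyAB-after-B {a} {b} {y} (≰⇒> a+y≰22) 4≤b)

choose-preserves : ∀ ℓ y → 0ℚ ≤ y → y ≤ ℕ→ℚ 16 → total ℓ + y ≤ ℕ→ℚ 48 →
  Invariant ℓ → Invariant (put (choose ℓ y) y ℓ)
choose-preserves ⟨ a , b , c ⟩ y 0≤y y≤16 budget ((a≤22 , b≤22 , c≤22) , phase)
  with ℕ→ℚ 26 ≤? a + b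
... | yes 26≤a+b = (a≤22 , b≤22 , rest-≤22 26≤a+b C-budget) , heavyAB 26≤a+b
  where
  C-budget : (a + b) + (c + y) ≤ ℕ→ℚ 48
  C-budget = subst (_≤ ℕ→ℚ 48) (+-assoc (a + b) c y) budget
... | no 26≰a+b with ℕ→ℚ 26 ≤? a + c
...   | yes 26≤a+c = (a≤22 , rest-≤22 26≤a+c B-budget , c≤22) , heavyAC 26≤a+c
  where
  B-budget : (a + c) + (b + y) ≤ ℕ→ℚ 48
  B-budget = subst (_≤ ℕ→ℚ 48)
    (solve 4 (λ a b c y → ((a :+ b) :+ c) :+ y := (a :+ c) :+ (b :+ y)) refl a b c y) budget
...   | no 26≰a+c with phase
...     | heavyAB 26≤a+b = ⊥-elim (26≰a+b 26≤a+b)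
...     | heavyAC 26≤a+c = ⊥-elim (26≰a+c 26≤a+c)
...     | balanced b+4≤a+c 4≤b c≤6 =
  balancedChoice-preserves y 0≤y y≤16 a≤22 b≤22 c≤22 b+4≤a+c 4≤b c≤6

algorithm : OnlineAlg
algorithm q = choose (loads q)

algorithm-preserves : ∀ q r → ValidSizes r → sumℚ (items q ++ r) ≤ ℕ→ℚ 48 →
  Invariant (loads q) → Invariant (loads (run algorithm q r))
algorithm-preserves = run-preserves algorithm (ℕ→ℚ 48) (λ q → Invariant (loads q)) step
  where
  step : ∀ q y → 0ℚ ≤ y → y ≤ ℕ→ℚ 16 → sumℚ (items q) + y ≤ ℕ→ℚ 48 →
    Invariant (loads q) → Invariant (loads (q ++ [ (y , algorithm q y) ]))
  step q y 0≤y y≤16 budget inv =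
    subst Invariant (sym (loads-++-[] q y (algorithm q y)))
      (choose-preserves (loads q) y 0≤y y≤16
        (subst (λ t → t + y ≤ ℕ→ℚ 48) (sumℚ-items≡total q) budget) inv)

offline-volume≤48 : ∀ {xs} → OfflinePackable16 xs → sumℚ xs ≤ ℕ→ℚ 48
offline-volume≤48 (q , refl , q≤16) =
  subst (_≤ ℕ→ℚ 48) (sym (sumℚ-items≡total q)) (+-mono-≤ (+-mono-≤ (q≤16 A) (q≤16 B)) (q≤16 C))

Invariant⇒LoadsAtMost22 : ∀ q → Invariant (loads q) → LoadsAtMost (ℕ→ℚ 22) q
Invariant⇒LoadsAtMost22 q ((a≤22 , _ , _) , _) A = a≤22
Invariant⇒LoadsAtMost22 q ((_ , b≤22 , _) , _) B = b≤22
Invariant⇒LoadsAtMost22 q ((_ , _ , c≤22) , _) C = c≤22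

mainTheorem9 :
    (p : Packing) →
    ValidSizes (items p) →
    LoadsAtMost (ℕ→ℚ 22) p →
    load C p < ℕ→ℚ 4 →
    ℕ→ℚ 6 < load B p →
    (load B p + ℕ→ℚ 4) - load C p ≤ load A p →
    Σ OnlineAlg λ alg →
      (future : List ℚ) →
      ValidSizes future →
      OfflinePackable16 (items p ++ future) →
      LoadsAtMost (ℕ→ℚ 22) (run alg p future)
mainTheorem9 p _ p≤22 c<4 6<b b+4-c≤a = algorithm , λ future valid packable →
  Invariant⇒LoadsAtMost22 (run algorithm p future)
    (algorithm-preserves p future valid (offline-volume≤48 packable) start)
  where
  4≤6 : ℕ→ℚ 4 ≤ ℕ→ℚ 6
  4≤6 = ≤ᵇ⇒≤ _
  start : Invariant (loads p)
  start = (p≤22 A , p≤22 B , p≤22 C)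
        , balanced (p-q≤r⇒p≤r+q b+4-c≤a) (<⇒≤ (≤-<-trans 4≤6 6<b)) (<⇒≤ (<-≤-trans c<4 4≤6))
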